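{- Let $\mathbf t$ be the Tribonacci word and, for $n\in\mathbb N$, let $\mathcal Z(n)$ be as defined in the context. Let $N,n$ be positive integers. (i) If $\langle N\rangle_T=\langle n\rangle_T0$, then $\displaystyle\mathcal Z(N)=\bigcup_{\binom{z}{\tilde z}\in\mathcal Z(n)}\mathrm{Dec}\begin{pmatrix}\varphi(z)\\ \varphi(\tilde z)\end{pmatrix}$. (ii) If $\langle N\rangle_T=\langle n\rangle_T1$, then $\displaystyle\mathcal Z(N)=\bigcup_{\binom{z}{\tilde z}\in\mathcal Z(n)}\mathrm{Dec}\begin{pmatrix}\varphi(z)\\ 0^{ -1}\varphi(\tilde z)0\end{pmatrix}$.
   Context: The Tribonacci word $\mathbf t=0102010010201\cdots$ is the fixed point of the substitution $\varphi:0\mapsto01,\ 1\mapsto02,\ 2\mapsto0$. Tribonacci numbers: $T_0=T_1=0$, $T_2=1$, $T_j=T_{j-1}+T_{j-2}+T_{j-3}$; one has $|\varphi^j(0)|=T_{j+3}$. The normal $T$-representation $\langle n\rangle_T=d_k\cdots d_0$ of $n\in\mathbb N$ is the digit string with $d_j\in\{0,1\}$ and $n=\sum_j d_jT_{j+3}$ obtained by the greedy algorithm; $\langle n\rangle_T d$ denotes concatenation with the digit $d$. $\Psi(w)=(|w|_0,|w|_1,|w|_2)$ is the Parikh vector. For words $v,w$ with $\Psi(v)=\Psi(w)$, factorize $v=z_0\cdots z_h$, $w=\tilde z_0\cdots\tilde z_h$ with nonempty $z_j,\tilde z_j$, $\Psi(z_j)=\Psi(\tilde z_j)$, and $h$ maximal;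 $\mathrm{Dec}\binom{v}{w}=\{\binom{z_j}{\tilde z_j}:0\le j\le h\}$. For words $x,y$ with $x$ a prefix of $y$, $x^{ -1}y$ is $y$ with the prefix $x$ deleted. Let $\mathbf t_{[n]}$ be the length-$n$ prefix of $\mathbf t$. For $n\in\mathbb N$ define $\mathcal Z(n)=\mathrm{Dec}\binom{\varphi^{K+3}(0)}{\mathbf t_{[n]}^{ -1}\varphi^{K+3}(0)\mathbf t_{[n]}}$ for any integer $K\ge0$ with $n\le T_{K+3}$ (this set does not depend on the choice of such $K$). -}

module Defs where

import Data.Nat as ℕ
open import Data.Nat using (ℕ; zero; suc; _+_; _∸_; _≤_; _<_; _≤ᵇ_)
open import Data.Bool using (Bool; true; false; if_then_else_)
open import Data.Fin using (Fin; zero; suc)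
open import Data.Fin.Properties using (_≟_)
open import Data.List using (List; []; _∷_; _++_; length; take; drop; filter; concat; concatMap; map; dropWhile)
open import Data.List.Membership.Propositional using (_∈_)
open import Data.List.Relation.Unary.All using (All)
open import Data.Product using (_×_; _,_; Σ; proj₁; proj₂)
open import Relation.Binary.PropositionalEquality using (_≡_; _≢_)
open import Relation.Nullary using (¬_)
open import Relation.Nullary.Decidable using (does)

Letter : Set
Letter = Fin 3

Word : Set
Word = List Letter

l0 l1 l2 : Letter
l0 = zero
l1 = suc zero
l2 = suc (suc zero)

φ : Letter → Word
φ zero = l0 ∷ l1 ∷ []
φ (suc zero) = l0 ∷ l2 ∷ []
φ (suc (suc zero)) = l0 ∷ []

φ* : Word → Word
φ* = concatMap φ

φ^ : ℕ → Word → Word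
φ^ zero w = w
φ^ (suc j) w = φ* (φ^ j w)

T : ℕ → ℕ
T zero = 0
T (suc zero) = 0
T (suc (suc zero)) = 1
T (suc (suc (suc j))) = T (suc (suc j)) + T (suc j) + T j

-- Length-n prefix t_[n] of the Tribonacci word t = lim φ^j(0).
-- Since φ^j(0) is a prefix of t and |φ^n(0)| = T_{n+3} ≥ n, this is the length-n prefix of t.
tPrefix : ℕ → Word
tPrefix n = take n (φ^ n (l0 ∷ []))

greedy : ℕ → ℕ → List ℕ
greedy zero n = if T 3 ≤ᵇ n then 1 ∷ [] else 0 ∷ []
greedy (suc k) n =
  if T (suc k + 3) ≤ᵇ n then 1 ∷ greedy k (n ∸ T (suc k + 3))
                         else 0 ∷ greedy k n

-- Normal T-representation ⟨n⟩_T: greedy digits starting at position k = n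
-- (large enough since T_{n+3} > n), with leading zeros removed
-- (so ⟨0⟩_T is the empty string).
reprT : ℕ → List ℕ
reprT n = dropWhile (ℕ._≟ 0) (greedy n n)

count : Letter → Word → ℕ
count a w = length (filter (_≟ a) w)

Ψ : Word → ℕ × ℕ × ℕ
Ψ w = count l0 w , count l1 w , count l2 w

IsFactorization : Word → Word → List (Word × Word) → Set
IsFactorization v w F =
  concat (map proj₁ F) ≡ v × concat (map proj₂ F) ≡ w ×
  All (λ p → proj₁ p ≢ [] × proj₂ p ≢ [] × Ψ (proj₁ p) ≡ Ψ (proj₂ p)) F

_∈Dec_/_ : Word × Word → Word → Word → Set
p ∈Dec v / w = Σ (List (Word × Word)) λ F →
  IsFactorization v w F ×
  (∀ G → IsFactorization v w G → length G ≤ length F) ×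
  p ∈ F

-- x⁻¹ y : y with the prefix x deleted (only used when x is a prefix of y)
_⁻¹·_ : Word → Word → Word
x ⁻¹· y = drop (length x) y

-- Z(n) computed with parameter K (requires n ≤ T_{K+3}):
-- Dec( φ^{K+3}(0) over t_[n]⁻¹ φ^{K+3}(0) t_[n] )
_∈Z[_,_] : Word × Word → ℕ → ℕ → Set
p ∈Z[ n , K ] =
  p ∈Dec (φ^ (K + 3) (l0 ∷ []))
       / (tPrefix n ⁻¹· (φ^ (K + 3) (l0 ∷ []) ++ tPrefix n))

-- Dec(v / w) is the set of blocks of the unique factorization of (v , w) into atomic blocks, those
-- with no proper prefix pair of equal Parikh vectors: a maximal factorization must be atomic, and
-- refining any factorization blockwise into atoms yields the atomic one. Hence the Dec of a
-- concatenation is the union of the Decs of its factors.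
--
-- If φ^m(0) = t[n] s then t[n]⁻¹ φ^m(0) t[n] = s t[n]. Since φ preserves equality of Parikh vectors,
-- it maps the atomic factorization of (t[n] s , s t[n]) to a factorization of (φ^{m+1}(0) , φ(s) φ(t[n])),
-- and conjugating every lower word by 0 gives one of (φ^{m+1}(0) , 0⁻¹ φ(s) φ(t[n]) 0). As
-- t[N] = φ(t[n]) 0^d for N = |φ(t[n])| + d, these are the pairs defining Z(N) one level higher.
-- Finally ⟨N⟩_T = ⟨n⟩_T d forces N = |φ(t[n])| + d, because shifting the greedy digits one place up
-- turns n = Σ d_j T_{j+3} into Σ d_j T_{j+4} = |φ(t[n])|. Independence of the level follows by
-- induction on n along the same recursion, starting from the diagonal case n = 0.

module Submission where

open import Defs
open import Data.Nat
  using (ℕ; zero; suc; _+_; _∸_; _*_; _<_; _≤_; _≤′_; ≤′-refl; ≤′-step; _≤ᵇ_; z≤n; s≤s; z<s)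
open import Data.Nat.Properties
  using ( +-comm; +-assoc; +-suc; +-identityʳ; *-identityˡ; *-identityʳ; +-cancelˡ-≡; +-cancelˡ-<
        ; +-mono-≤; +-monoʳ-≤; +-monoˡ-≤; ≤-refl; ≤-trans; ≤-reflexive; ≤-pred; ≤-total; <-trans; <-≤-trans
        ; <⇒≤; <-irrefl; <-cmp; ≰⇒>; ≤⇒≤′; m<m+n; m≤m+n; m≤n+m; n≤1+n; n<1+n; m≤n⇒m≤1+n; m+[n∸m]≡n
        ; m<n⇒0<n∸m; ∸-monoʳ-<; m≤n⇒m⊓n≡m; ≤ᵇ-reflects-≤; _<?_; _≤?_; anyUpTo? )
import Data.Nat.Properties as ℕ
open import Data.Nat.Induction using (<-wellFounded; <-rec)
open import Data.Nat.Solver using (module +-*-Solver)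
open import Data.Bool using (true; false)
open import Data.Fin using (Fin; zero; suc; toℕ; fromℕ<)
open import Data.Fin.Properties using (toℕ-fromℕ<)
open import Data.List using (List; []; _∷_; _++_; length; take; drop; filter; concat; map; dropWhile; lookup)
open import Data.List.Properties
  using ( length-++; length-take; length-drop; map-++; concat-++; concatMap-++; filter-++
        ; take++drop≡id; take-suc; take-all; ++-assoc; ++-identityʳ; ++-cancelˡ )
open import Data.List.Relation.Unary.All using (All; []; _∷_)
open import Data.List.Relation.Unary.All.Properties using (++⁺)
open import Data.List.Relation.Unary.Any using (here; there)
open import Data.List.Membership.Propositional using (_∈_)
open import Data.List.Membership.Propositional.Properties using (∈-++⁻; ∈-++⁺ˡ; ∈-++⁺ʳ; ∈-map⁺; ∈-map⁻)
open import Data.Product using (_×_; _,_; Σ; ∃; ∃-syntax; proj₁; proj₂; map₁; map₂)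
open import Data.Product.Properties using (≡-dec)
open import Data.Sum using (_⊎_; inj₁; inj₂)
open import Data.Empty using (⊥-elim)
open import Function using (_∘_)
open import Function.Bundles using (_⇔_; mk⇔; Equivalence)
open import Function.Construct.Composition using (_⇔-∘_)
open import Function.Construct.Symmetry using (⇔-sym)
open import Function.Properties.Equivalence using (⇔-setoid)
open import Induction.WellFounded using (Acc; acc)
open import Level using (0ℓ)
open import Relation.Binary.Definitions using (tri<; tri≈; tri>)
open import Relation.Binary.PropositionalEquality
  using (_≡_; _≢_; refl; sym; trans; cong; cong₂; subst; subst₂; module ≡-Reasoning)
open import Relation.Nullary using (¬_; Dec; yes; no; ofʸ; ofⁿ)
open import Relation.Nullary.Decidable using (_×-dec_)

private
  variable
    A : Set
    a b c d v w : Word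
    F G H : List (Word × Word)

take-++ˡ : ∀ n (xs ys : List A) → n ≤ length xs → take n (xs ++ ys) ≡ take n xs
take-++ˡ zero    xs       ys _         = refl
take-++ˡ (suc n) (x ∷ xs) ys (s≤s n≤) = cong (x ∷_) (take-++ˡ n xs ys n≤)

take-++ʳ : ∀ n (xs ys : List A) → length xs ≤ n → take n (xs ++ ys) ≡ xs ++ take (n ∸ length xs) ys
take-++ʳ n       []       ys _         = refl
take-++ʳ (suc n) (x ∷ xs) ys (s≤s ≤n) = cong (x ∷_) (take-++ʳ n xs ys ≤n)

take-length-++ : ∀ (xs ys : List A) → take (length xs) (xs ++ ys) ≡ xs
take-length-++ []       ys = refl
take-length-++ (x ∷ xs) ys = cong (x ∷_) (take-length-++ xs ys)

drop-length-++ : ∀ (xs ys : List A) → drop (length xs) (xs ++ ys) ≡ ys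
drop-length-++ []       ys = refl
drop-length-++ (x ∷ xs) ys = drop-length-++ xs ys

take-of-++-prefix : ∀ (xs ys : List A) {xs' ys'} → xs ++ xs' ≡ ys ++ ys' → length xs ≤ length ys →
                    take (length xs) ys ≡ xs
take-of-++-prefix xs ys {xs'} {ys'} e ≤ys =
  trans (sym (take-++ˡ (length xs) ys ys' ≤ys)) (trans (cong (take (length xs)) (sym e)) (take-length-++ xs xs'))

length-take-≤ : ∀ n (xs : List A) → n ≤ length xs → length (take n xs) ≡ n
length-take-≤ n xs n≤ = trans (length-take n xs) (m≤n⇒m⊓n≡m n≤)

take-suc-∷ʳ : ∀ n (xs : List A) → n < length xs → ∃ λ a → take (suc n) xs ≡ take n xs ++ a ∷ []
take-suc-∷ʳ n xs n< =
  lookup xs i ,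
  subst (λ m → take (suc m) xs ≡ take m xs ++ lookup xs i ∷ []) (toℕ-fromℕ< n<) (take-suc xs i)
  where
  i : Fin (length xs)
  i = fromℕ< n<

take-shorter : ∀ i (x : List A) → i < length x → length (take i x) < length x
take-shorter i x i<x = subst (_< length x) (sym (length-take-≤ i x (<⇒≤ i<x))) i<x

drop-shorter : ∀ i (x : List A) → 0 < i → i < length x → length (drop i x) < length x
drop-shorter i x 0<i i<x = subst (_< length x) (sym (length-drop i x)) (∸-monoʳ-< 0<i (<⇒≤ i<x))

++-nonempty : ∀ (xs ys : List A) → xs ≢ [] → xs ++ ys ≢ []
++-nonempty []      _ xs≢[] _ = xs≢[] refl
++-nonempty (_ ∷ _) _ _     ()

nonempty⇒0<length : ∀ (xs : List A) → xs ≢ [] → 0 < length xs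
nonempty⇒0<length []      xs≢[] = ⊥-elim (xs≢[] refl)
nonempty⇒0<length (_ ∷ _) _     = s≤s z≤n

0<length⇒nonempty : ∀ (xs : List A) → 0 < length xs → xs ≢ []
0<length⇒nonempty (_ ∷ _) _ ()

infix 4 _≼_
_≼_ : Word → Word → Set
x ≼ y = ∃ λ r → y ≡ x ++ r

≼-trans : ∀ {x y z} → x ≼ y → y ≼ z → x ≼ z
≼-trans {x} (r , refl) (s , refl) = r ++ s , ++-assoc x r s

take-≼ : ∀ n (y : Word) → take n y ≼ y
take-≼ n y = drop n y , sym (take++drop≡id n y)

≼-length : ∀ {x y} → x ≼ y → length x ≤ length y
≼-length {x} (r , refl) = subst (length x ≤_) (sym (length-++ x)) (m≤m+n _ _)

take-of-≼ : ∀ {x y : Word} → x ≼ y → ∀ n → n ≤ length x → take n y ≡ take n x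
take-of-≼ {x} (r , refl) n n≤ = take-++ˡ n x r n≤

⁻¹·-conjugate : ∀ y x e → (y ++ e) ⁻¹· ((y ++ x) ++ (y ++ e)) ≡ e ⁻¹· ((x ++ y) ++ e)
⁻¹·-conjugate y x e = begin
  drop (length (y ++ e)) ((y ++ x) ++ y ++ e)        ≡⟨ cong₂ drop (length-++ y) (++-assoc y x (y ++ e)) ⟩
  drop (length y + length e) (y ++ x ++ y ++ e)      ≡⟨ drop-length-+ y ⟩
  drop (length e) (x ++ y ++ e)                      ≡⟨ cong (drop (length e)) (sym (++-assoc x y e)) ⟩
  drop (length e) ((x ++ y) ++ e)                    ∎
  where
  open ≡-Reasoning
  drop-length-+ : ∀ y {k z} → drop (length y + k) (y ++ z) ≡ drop k z
  drop-length-+ []      = refl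
  drop-length-+ (_ ∷ y) = drop-length-+ y

Parikh : Set
Parikh = ℕ × ℕ × ℕ

_⊕_ : Parikh → Parikh → Parikh
(x , y , z) ⊕ (x' , y' , z') = x + x' , y + y' , z + z'

⊕-comm : ∀ u u' → u ⊕ u' ≡ u' ⊕ u
⊕-comm (x , y , z) (x' , y' , z') = cong₂ _,_ (+-comm x x') (cong₂ _,_ (+-comm y y') (+-comm z z'))

⊕-cancelˡ : ∀ u {u' u''} → u ⊕ u' ≡ u ⊕ u'' → u' ≡ u''
⊕-cancelˡ (x , y , z) {_ , _ , _} {_ , _ , _} e =
  cong₂ _,_ (+-cancelˡ-≡ x _ _ (cong proj₁ e))
    (cong₂ _,_ (+-cancelˡ-≡ y _ _ (cong (proj₁ ∘ proj₂) e))
               (+-cancelˡ-≡ z _ _ (cong (proj₂ ∘ proj₂) e)))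

_≟Ψ_ : (u u' : Parikh) → Dec (u ≡ u')
_≟Ψ_ = ≡-dec ℕ._≟_ (≡-dec ℕ._≟_ ℕ._≟_)

size : Parikh → ℕ
size (x , y , z) = x + y + z

count-++ : ∀ l (x y : Word) → count l (x ++ y) ≡ count l x + count l y
count-++ l x y = trans (cong length (filter-++ (_≟ l) x y)) (length-++ (filter (_≟ l) x))
  where open import Data.Fin.Properties using (_≟_)

Ψ-++ : ∀ x y → Ψ (x ++ y) ≡ Ψ x ⊕ Ψ y
Ψ-++ x y = cong₂ _,_ (count-++ l0 x y) (cong₂ _,_ (count-++ l1 x y) (count-++ l2 x y))

Ψ-++-comm : ∀ x y → Ψ (x ++ y) ≡ Ψ (y ++ x)
Ψ-++-comm x y = trans (Ψ-++ x y) (trans (⊕-comm (Ψ x) (Ψ y)) (sym (Ψ-++ y x)))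

length≡size∘Ψ : ∀ w → length w ≡ size (Ψ w)
length≡size∘Ψ []                   = refl
length≡size∘Ψ (zero ∷ w)           = cong suc (length≡size∘Ψ w)
length≡size∘Ψ (suc zero ∷ w)       =
  trans (cong suc (length≡size∘Ψ w)) (cong (_+ count l2 w) (sym (+-suc (count l0 w) (count l1 w))))
length≡size∘Ψ (suc (suc zero) ∷ w) =
  trans (cong suc (length≡size∘Ψ w)) (sym (+-suc (count l0 w + count l1 w) (count l2 w)))

Ψ-length : ∀ a b → Ψ a ≡ Ψ b → length a ≡ length b
Ψ-length a b e = trans (length≡size∘Ψ a) (trans (cong size e) (sym (length≡size∘Ψ b)))

-- Factorizations into blocks with equal Parikh vectors

Block : Word × Word → Set
Block (a , b) = a ≢ [] × b ≢ [] × Ψ a ≡ Ψ b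

tops bottoms : List (Word × Word) → Word
tops F = concat (map proj₁ F)
bottoms F = concat (map proj₂ F)

tops-++ : ∀ F G → tops (F ++ G) ≡ tops F ++ tops G
tops-++ F G = trans (cong concat (map-++ proj₁ F G)) (sym (concat-++ (map proj₁ F) (map proj₁ G)))

bottoms-++ : ∀ F G → bottoms (F ++ G) ≡ bottoms F ++ bottoms G
bottoms-++ F G = trans (cong concat (map-++ proj₂ F G)) (sym (concat-++ (map proj₂ F) (map proj₂ G)))

conjugate-block : ∀ x y → x ++ y ≢ [] → Block (x ++ y , y ++ x)
conjugate-block x y xy≢[] =
  xy≢[] ,
  0<length⇒nonempty (y ++ x)
    (subst (0 <_) (Ψ-length (x ++ y) (y ++ x) (Ψ-++-comm x y)) (nonempty⇒0<length (x ++ y) xy≢[])) ,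
  Ψ-++-comm x y

Cut : Word × Word → ℕ → Set
Cut (a , b) i = 0 < i × Ψ (take i a) ≡ Ψ (take i b)

Atomic : Word × Word → Set
Atomic p = ¬ (∃[ i ] i < length (proj₁ p) × Cut p i)

AtomicFactorization : Word → Word → List (Word × Word) → Set
AtomicFactorization v w F = IsFactorization v w F × All Atomic F

Maximal : Word → Word → List (Word × Word) → Set
Maximal v w F = ∀ G → IsFactorization v w G → length G ≤ length F

split-block : ∀ i → Block (a , b) → i < length a → Cut (a , b) i →
              Block (take i a , take i b) × Block (drop i a , drop i b)
split-block {a} {b} i (a≢[] , b≢[] , Ψa≡Ψb) i<a (0<i , cut) =
  (nonempty-take a i<a , nonempty-take b i<b , cut) ,
  (nonempty-drop a i<a , nonempty-drop b i<b , ⊕-cancelˡ (Ψ (take i a)) suffixes)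
  where
  i<b : i < length b
  i<b = subst (i <_) (Ψ-length a b Ψa≡Ψb) i<a
  nonempty-take : ∀ x → i < length x → take i x ≢ []
  nonempty-take x i<x = 0<length⇒nonempty _ (subst (0 <_) (sym (length-take-≤ i x (<⇒≤ i<x))) 0<i)
  nonempty-drop : ∀ x → i < length x → drop i x ≢ []
  nonempty-drop x i<x = 0<length⇒nonempty _ (subst (0 <_) (sym (length-drop i x)) (m<n⇒0<n∸m i<x))
  Ψ-split : ∀ x → Ψ x ≡ Ψ (take i x) ⊕ Ψ (drop i x)
  Ψ-split x = trans (cong Ψ (sym (take++drop≡id i x))) (Ψ-++ (take i x) (drop i x))
  suffixes : Ψ (take i a) ⊕ Ψ (drop i a) ≡ Ψ (take i a) ⊕ Ψ (drop i b)
  suffixes = trans (sym (Ψ-split a)) (trans Ψa≡Ψb (trans (Ψ-split b) (cong (_⊕ Ψ (drop i b)) (sym cut))))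

cut? : ∀ p → Dec (∃[ i ] i < length (proj₁ p) × Cut p i)
cut? (a , b) = anyUpTo? (λ i → (0 <? i) ×-dec (Ψ (take i a) ≟Ψ Ψ (take i b))) (length a)

factorization-++ : ∀ i → IsFactorization (take i a) (take i b) F → IsFactorization (drop i a) (drop i b) G →
                   IsFactorization a b (F ++ G)
factorization-++ {a} {b} {F} {G} i (u₁ , l₁ , bs₁) (u₂ , l₂ , bs₂) =
  trans (tops-++ F G) (trans (cong₂ _++_ u₁ u₂) (take++drop≡id i a)) ,
  trans (bottoms-++ F G) (trans (cong₂ _++_ l₁ l₂) (take++drop≡id i b)) ,
  ++⁺ bs₁ bs₂

atomicFactorization : Block (a , b) → ∃ (AtomicFactorization a b)
atomicFactorization {a} {b} = go a b (<-wellFounded (length a))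
  where
  go : ∀ a b → Acc _<_ (length a) → Block (a , b) → ∃ (AtomicFactorization a b)
  go a b _ blk with cut? (a , b)
  ... | no atomic = (a , b) ∷ [] , (++-identityʳ a , ++-identityʳ b , blk ∷ []) , atomic ∷ []
  go a b (acc rec) blk | yes (i , i<a , cut@(0<i , _))
    with blk₁ , blk₂ ← split-block i blk i<a cut
    with F₁ , fac₁ , as₁ ← go (take i a) (take i b) (rec (take-shorter i a i<a)) blk₁
       | F₂ , fac₂ , as₂ ← go (drop i a) (drop i b) (rec (drop-shorter i a 0<i i<a)) blk₂ =
    F₁ ++ F₂ , factorization-++ i fac₁ fac₂ , ++⁺ as₁ as₂

common-prefix : ∀ (a c : Word) {x y} → a ++ x ≡ c ++ y → length a ≡ length c → a ≡ c
common-prefix a c {x} {y} e |a|≡|c| = begin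
  a                                ≡⟨ sym (take-length-++ a x) ⟩
  take (length a) (a ++ x)         ≡⟨ cong₂ take |a|≡|c| e ⟩
  take (length c) (c ++ y)         ≡⟨ take-length-++ c y ⟩
  c                                ∎
  where open ≡-Reasoning

-- A block which is a proper prefix of an atomic block would cut it.
no-shorter-block : Block (a , b) → Block (c , d) → Atomic (c , d) → ∀ {x x' y y'} →
                   a ++ x ≡ c ++ y → b ++ x' ≡ d ++ y' → ¬ length a < length c
no-shorter-block {a} {b} {c} {d} (a≢[] , _ , Ψa≡Ψb) (_ , _ , Ψc≡Ψd) atomic e e' a<c =
  atomic (length a , a<c , nonempty⇒0<length a a≢[] , cut)
  where
  |a|≡|b| : length a ≡ length b
  |a|≡|b| = Ψ-length a b Ψa≡Ψb
  b≤d : length b ≤ length d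
  b≤d = subst₂ _≤_ |a|≡|b| (Ψ-length c d Ψc≡Ψd) (<⇒≤ a<c)
  cut : Ψ (take (length a) c) ≡ Ψ (take (length a) d)
  cut = trans (cong Ψ (take-of-++-prefix a c e (<⇒≤ a<c)))
          (trans Ψa≡Ψb (cong Ψ (sym (trans (cong (λ n → take n d) |a|≡|b|) (take-of-++-prefix b d e' b≤d)))))

atomic-unique : AtomicFactorization v w F → AtomicFactorization v w G → F ≡ G
atomic-unique {F = []}    {G = []}    _ _ = refl
atomic-unique {F = []}    {G = (c , _) ∷ _} ((refl , _) , _) ((uG , _ , (c≢[] , _) ∷ _) , _) =
  ⊥-elim (++-nonempty c _ c≢[] uG)
atomic-unique {F = (a , _) ∷ _} {G = []} ((uF , _ , (a≢[] , _) ∷ _) , _) ((refl , _) , _) =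
  ⊥-elim (++-nonempty a _ a≢[] uF)
atomic-unique {F = (a , b) ∷ F} {G = (c , d) ∷ G}
              ((uF , lF , bF ∷ bsF) , aF ∷ asF) ((uG , lG , bG ∷ bsG) , aG ∷ asG)
  with <-cmp (length a) (length c)
... | tri< a<c _ _ = ⊥-elim (no-shorter-block bF bG aG (trans uF (sym uG)) (trans lF (sym lG)) a<c)
... | tri> _ _ c<a = ⊥-elim (no-shorter-block bG bF aF (trans uG (sym uF)) (trans lG (sym lF)) c<a)
... | tri≈ _ |a|≡|c| _
  with refl ← common-prefix a c (trans uF (sym uG)) |a|≡|c|
  with refl ← common-prefix b d (trans lF (sym lG))
                (trans (sym (Ψ-length a b (proj₂ (proj₂ bF))))
                       (trans |a|≡|c| (Ψ-length c d (proj₂ (proj₂ bG))))) =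
  cong ((a , b) ∷_)
    (atomic-unique ((refl , refl , bsF) , asF)
                   ((++-cancelˡ a _ _ (trans uG (sym uF)) , ++-cancelˡ b _ _ (trans lG (sym lF)) , bsG) , asG))

maximal⇒atomic : IsFactorization v w F → Maximal v w F → All Atomic F
maximal⇒atomic {F = []} _ _ = []
maximal⇒atomic {F = (a , b) ∷ F} (uF , lF , blk ∷ bs) max =
  atomic ∷ maximal⇒atomic (refl , refl , bs) max-tail
  where
  max-tail : Maximal (tops F) (bottoms F) F
  max-tail G (uG , lG , bsG) =
    ≤-pred (max ((a , b) ∷ G) (trans (cong (a ++_) uG) uF , trans (cong (b ++_) lG) lF , blk ∷ bsG))
  split-at : ∀ i (x y : Word) → take i x ++ drop i x ++ y ≡ x ++ y
  split-at i x y = trans (sym (++-assoc (take i x) (drop i x) y)) (cong (_++ y) (take++drop≡id i x))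
  atomic : Atomic (a , b)
  atomic (i , i<a , cut) with blk₁ , blk₂ ← split-block i blk i<a cut =
    <-irrefl refl
      (max ((take i a , take i b) ∷ (drop i a , drop i b) ∷ F)
           (trans (split-at i a (tops F)) uF , trans (split-at i b (bottoms F)) lF , blk₁ ∷ blk₂ ∷ bs))

data Refines : List (Word × Word) → List (Word × Word) → Set where
  []  : Refines [] []
  _∷_ : ∀ {a b H F G} → AtomicFactorization a b H → Refines F G → Refines ((a , b) ∷ F) (H ++ G)

refinement : All Block F → ∃ (Refines F)
refinement {[]}          []         = [] , []
refinement {(a , b) ∷ F} (blk ∷ bs)
  with H , atH ← atomicFactorization blk | G , r ← refinement bs = H ++ G , atH ∷ r

refines-atomic : IsFactorization v w F → Refines F G → AtomicFactorization v w G
refines-atomic (refl , refl , []) [] = (refl , refl , []) , []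
refines-atomic (uF , lF , _ ∷ bs) (_∷_ {H = H} {G = G} ((uH , lH , bsH) , asH) r)
  with (uG , lG , bsG) , asG ← refines-atomic (refl , refl , bs) r =
  (trans (tops-++ H G) (trans (cong₂ _++_ uH uG) uF) ,
   trans (bottoms-++ H G) (trans (cong₂ _++_ lH lG) lF) ,
   ++⁺ bsH bsG) ,
  ++⁺ asH asG

factorization-nonempty : a ≢ [] → IsFactorization a b H → 0 < length H
factorization-nonempty {H = []}    a≢[] (u , _) = ⊥-elim (a≢[] (sym u))
factorization-nonempty {H = _ ∷ _} _    _       = s≤s z≤n

refines-length : All Block F → Refines F G → length F ≤ length G
refines-length [] [] = z≤n
refines-length ((a≢[] , _) ∷ bs) (_∷_ {H = H} (facH , _) r) =
  subst (suc _ ≤_) (sym (length-++ H)) (+-mono-≤ (factorization-nonempty a≢[] facH) (refines-length bs r))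

∈Dec⇔∈ : AtomicFactorization v w H → ∀ p → p ∈Dec v / w ⇔ p ∈ H
∈Dec⇔∈ {v} {w} {H} atH p = mk⇔ to from
  where
  to : p ∈Dec v / w → p ∈ H
  to (F , facF , maxF , p∈F) = subst (p ∈_) (atomic-unique (facF , maximal⇒atomic facF maxF) atH) p∈F
  maximal : Maximal v w H
  maximal G facG@(_ , _ , bsG) with G' , r ← refinement bsG =
    subst (length G ≤_) (cong length (atomic-unique (refines-atomic facG r) atH)) (refines-length bsG r)
  from : p ∈ H → p ∈Dec v / w
  from p∈H = H , proj₁ atH , maximal , p∈H

infix 4 _∈Decᵖ_
_∈Decᵖ_ : Word × Word → Word × Word → Set
p ∈Decᵖ q = p ∈Dec proj₁ q / proj₂ q

InSomeDec : List (Word × Word) → Word × Word → Set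
InSomeDec F p = ∃[ q ] q ∈ F × p ∈Decᵖ q

refines-∈ : Refines F G → ∀ p → p ∈ G ⇔ InSomeDec F p
refines-∈ [] p = mk⇔ (λ ()) (λ ())
refines-∈ (_∷_ {a} {b} {H} atH r) p = mk⇔ to from
  where
  to : p ∈ H ++ _ → InSomeDec ((a , b) ∷ _) p
  to p∈ with ∈-++⁻ H p∈
  ... | inj₁ p∈H = (a , b) , here refl , Equivalence.from (∈Dec⇔∈ atH p) p∈H
  ... | inj₂ p∈G = map₂ (map₁ there) (Equivalence.to (refines-∈ r p) p∈G)
  from : InSomeDec ((a , b) ∷ _) p → p ∈ H ++ _
  from (_ , here refl , p∈Dec) = ∈-++⁺ˡ (Equivalence.to (∈Dec⇔∈ atH p) p∈Dec)
  from (q , there q∈F , p∈Dec) = ∈-++⁺ʳ H (Equivalence.from (refines-∈ r p) (q , q∈F , p∈Dec))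

∈Dec-concat : IsFactorization v w F → ∀ p → p ∈Dec v / w ⇔ InSomeDec F p
∈Dec-concat facF@(_ , _ , bs) p with G , r ← refinement bs =
  refines-∈ r p ⇔-∘ ∈Dec⇔∈ (refines-atomic facF r) p

∈Dec-image : ∀ (f : Word × Word → Word × Word) {v' w'} → AtomicFactorization v w H →
             IsFactorization v' w' (map f H) → ∀ p →
             p ∈Dec v' / w' ⇔ (∃[ q ] q ∈Dec v / w × p ∈Decᵖ f q)
∈Dec-image {v = v} {w = w} {H = H} f atH fac p = mk⇔ to from ⇔-∘ ∈Dec-concat fac p
  where
  to : InSomeDec (map f H) p → ∃[ q ] q ∈Dec v / w × p ∈Decᵖ f q
  to (_ , fq∈ , p∈Dec) with q , q∈H , refl ← ∈-map⁻ f fq∈ =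
    q , Equivalence.from (∈Dec⇔∈ atH q) q∈H , p∈Dec
  from : ∃[ q ] q ∈Dec v / w × p ∈Decᵖ f q → InSomeDec (map f H) p
  from (q , q∈Dec , p∈Dec) = f q , ∈-map⁺ f (Equivalence.to (∈Dec⇔∈ atH q) q∈Dec) , p∈Dec

diag : Letter → Word × Word
diag a = a ∷ [] , a ∷ []

diagonal-atomic : ∀ w → AtomicFactorization w w (map diag w)
diagonal-atomic []      = (refl , refl , []) , []
diagonal-atomic (a ∷ w) with (u , l , bs) , as ← diagonal-atomic w =
  (cong (a ∷_) u , cong (a ∷_) l , ((λ ()) , (λ ()) , refl) ∷ bs) , single ∷ as
  where
  single : Atomic (diag a)
  single (zero  , _         , () , _)
  single (suc _ , s≤s () , _)

-- The words φ^k(0)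

Φ : ℕ → Word
Φ j = φ^ j (l0 ∷ [])

φ*-++ : ∀ x y → φ* (x ++ y) ≡ φ* x ++ φ* y
φ*-++ = concatMap-++ φ

φ^-++ : ∀ k x y → φ^ k (x ++ y) ≡ φ^ k x ++ φ^ k y
φ^-++ zero    x y = refl
φ^-++ (suc k) x y = trans (cong φ* (φ^-++ k x y)) (φ*-++ (φ^ k x) (φ^ k y))

φ^-suc : ∀ k w → φ^ (suc k) w ≡ φ^ k (φ* w)
φ^-suc zero    w = refl
φ^-suc (suc k) w = cong φ* (φ^-suc k w)

Φ-suc : ∀ k → Φ (suc k) ≡ Φ k ++ φ^ k (l1 ∷ [])
Φ-suc k = trans (φ^-suc k (l0 ∷ [])) (φ^-++ k (l0 ∷ []) (l1 ∷ []))

φ^-suc-l1 : ∀ k → φ^ (suc k) (l1 ∷ []) ≡ Φ k ++ φ^ k (l2 ∷ [])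
φ^-suc-l1 k = trans (φ^-suc k (l1 ∷ [])) (φ^-++ k (l0 ∷ []) (l2 ∷ []))

φ^-suc-l2 : ∀ k → φ^ (suc k) (l2 ∷ []) ≡ Φ k
φ^-suc-l2 k = φ^-suc k (l2 ∷ [])

φ^-2+-l1 : ∀ j → φ^ (2 + j) (l1 ∷ []) ≡ Φ (1 + j) ++ Φ j
φ^-2+-l1 j = trans (φ^-suc-l1 (suc j)) (cong (Φ (suc j) ++_) (φ^-suc-l2 j))

Φ-3+ : ∀ j → Φ (3 + j) ≡ Φ (2 + j) ++ Φ (1 + j) ++ Φ j
Φ-3+ j = trans (Φ-suc (2 + j)) (cong (Φ (2 + j) ++_) (φ^-2+-l1 j))

φ^-l1-≼-Φ : ∀ j → φ^ (2 + j) (l1 ∷ []) ≼ Φ (2 + j)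
φ^-l1-≼-Φ j = φ^ j (l2 ∷ []) , (begin
  Φ (2 + j)                                   ≡⟨ Φ-suc (suc j) ⟩
  Φ (1 + j) ++ φ^ (1 + j) (l1 ∷ [])           ≡⟨ cong (Φ (1 + j) ++_) (φ^-suc-l1 j) ⟩
  Φ (1 + j) ++ Φ j ++ φ^ j (l2 ∷ [])          ≡⟨ sym (++-assoc (Φ (1 + j)) (Φ j) _) ⟩
  (Φ (1 + j) ++ Φ j) ++ φ^ j (l2 ∷ [])        ≡⟨ cong (_++ φ^ j (l2 ∷ [])) (sym (φ^-2+-l1 j)) ⟩
  φ^ (2 + j) (l1 ∷ []) ++ φ^ j (l2 ∷ [])      ∎)
  where open ≡-Reasoning

Φ-≼-mono : ∀ {j k} → j ≤ k → Φ j ≼ Φ k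
Φ-≼-mono j≤k = go (≤⇒≤′ j≤k)
  where
  go : ∀ {j k} → j ≤′ k → Φ j ≼ Φ k
  go {j} ≤′-refl    = [] , sym (++-identityʳ (Φ j))
  go {k = suc k} (≤′-step j≤′k) = ≼-trans (go j≤′k) (_ , Φ-suc k)

all-letters : ∀ m → 2 ≤ m → ∀ a → a ∈ Φ m
all-letters m 2≤m a with r , e ← Φ-≼-mono 2≤m = subst (a ∈_) (sym e) (∈-++⁺ˡ (in-Φ₂ a))
  where
  in-Φ₂ : ∀ a → a ∈ Φ 2
  in-Φ₂ zero             = here refl
  in-Φ₂ (suc zero)       = there (here refl)
  in-Φ₂ (suc (suc zero)) = there (there (there (here refl)))

φ-head : ∀ a → ∃ λ r → φ a ≡ l0 ∷ r
φ-head zero             = _ , refl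
φ-head (suc zero)       = _ , refl
φ-head (suc (suc zero)) = _ , refl

φ*-shape : ∀ x → φ* x ≡ [] ⊎ ∃ λ u → φ* x ≡ l0 ∷ u
φ*-shape []      = inj₁ refl
φ*-shape (a ∷ x) with r , e ← φ-head a = inj₂ (r ++ φ* x , cong (_++ φ* x) e)

φ*-nonempty : ∀ x → x ≢ [] → φ* x ≢ []
φ*-nonempty []      x≢[] = ⊥-elim (x≢[] refl)
φ*-nonempty (a ∷ x) _ with r , e ← φ-head a =
  λ φ*≡[] → ++-nonempty (l0 ∷ r) (φ* x) (λ ()) (trans (cong (_++ φ* x) (sym e)) φ*≡[])

φ*-∷ʳ : ∀ x a → φ* (x ++ a ∷ []) ≡ φ* x ++ φ a
φ*-∷ʳ x a = trans (φ*-++ x (a ∷ [])) (cong (φ* x ++_) (++-identityʳ (φ a)))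

Φ-nonempty : ∀ k → Φ k ≢ []
Φ-nonempty zero    ()
Φ-nonempty (suc k) = φ*-nonempty (Φ k) (Φ-nonempty k)

length-Φ : ∀ j → length (Φ j) ≡ T (3 + j)
length-Φ 0 = refl
length-Φ 1 = refl
length-Φ 2 = refl
length-Φ (suc (suc (suc j))) = begin
  length (Φ (3 + j))
    ≡⟨ cong length (Φ-3+ j) ⟩
  length (Φ (2 + j) ++ Φ (1 + j) ++ Φ j)
    ≡⟨ length-++ (Φ (2 + j)) ⟩
  length (Φ (2 + j)) + length (Φ (1 + j) ++ Φ j)
    ≡⟨ cong (length (Φ (2 + j)) +_) (length-++ (Φ (1 + j))) ⟩
  length (Φ (2 + j)) + (length (Φ (1 + j)) + length (Φ j))
    ≡⟨ cong₂ _+_ (length-Φ (suc (suc j))) (cong₂ _+_ (length-Φ (suc j)) (length-Φ j)) ⟩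
  T (5 + j) + (T (4 + j) + T (3 + j))
    ≡⟨ sym (+-assoc (T (5 + j)) _ _) ⟩
  T (6 + j)
    ∎
  where open ≡-Reasoning

T-suc-mono : ∀ j → T j ≤ T (suc j)
T-suc-mono 0 = z≤n
T-suc-mono 1 = z≤n
T-suc-mono 2 = s≤s z≤n
T-suc-mono (suc (suc (suc j))) = ≤-trans (m≤m+n (T (3 + j)) (T (2 + j))) (m≤m+n _ (T (1 + j)))

T-mono : ∀ {j k} → j ≤ k → T j ≤ T k
T-mono j≤k = go (≤⇒≤′ j≤k)
  where
  go : ∀ {j k} → j ≤′ k → T j ≤ T k
  go ≤′-refl        = ≤-refl
  go {k = suc k} (≤′-step j≤′k) = ≤-trans (go j≤′k) (T-suc-mono k)

0<T-2+ : ∀ j → 0 < T (2 + j)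
0<T-2+ 0 = s≤s z≤n
0<T-2+ 1 = s≤s z≤n
0<T-2+ (suc (suc j)) = ≤-trans (0<T-2+ (suc j)) (≤-trans (m≤m+n _ (T (2 + j))) (m≤m+n _ (T (1 + j))))

<T-3+ : ∀ j → j < T (3 + j)
<T-3+ zero    = s≤s z≤n
<T-3+ (suc j) = ≤-trans (s≤s (<T-3+ j))
  (subst (_≤ T (4 + j)) (+-comm (T (3 + j)) 1)
     (≤-trans (+-monoʳ-≤ (T (3 + j)) (0<T-2+ j)) (m≤m+n _ (T (1 + j)))))

TPrefix : Word → Set
TPrefix x = ∃ λ j → x ≼ Φ j

TPrefix-≼ : ∀ {x y} → TPrefix y → x ≼ y → TPrefix x
TPrefix-≼ (j , y≼) x≼ = j , ≼-trans x≼ y≼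

TPrefix-φ* : ∀ {x} → TPrefix x → TPrefix (φ* x)
TPrefix-φ* {x} (j , r , e) = suc j , φ* r , trans (cong φ* e) (φ*-++ x r)

n≤length-Φ : ∀ n → n ≤ length (Φ n)
n≤length-Φ n = subst (n ≤_) (sym (length-Φ n)) (<⇒≤ (<T-3+ n))

tPrefix-take : ∀ n j → n ≤ length (Φ j) → tPrefix n ≡ take n (Φ j)
tPrefix-take n j n≤ with ≤-total j n
... | inj₁ j≤n = take-of-≼ (Φ-≼-mono j≤n) n n≤
... | inj₂ n≤j = sym (take-of-≼ (Φ-≼-mono n≤j) n (n≤length-Φ n))

TPrefix-tPrefix : ∀ n → TPrefix (tPrefix n)
TPrefix-tPrefix n = n , take-≼ n (Φ n)

tPrefix-length : ∀ {x} → TPrefix x → tPrefix (length x) ≡ x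
tPrefix-length {x} (j , x≼) =
  trans (tPrefix-take (length x) j (≼-length x≼))
        (trans (take-of-≼ x≼ (length x) ≤-refl) (take-all (length x) x ≤-refl))

tPrefix-suc : ∀ n → ∃ λ a → tPrefix (suc n) ≡ tPrefix n ++ a ∷ []
tPrefix-suc n with a , e ← take-suc-∷ʳ n (Φ (suc n)) (n≤length-Φ (suc n)) =
  a , trans e (cong (_++ a ∷ []) (sym (tPrefix-take n (suc n) (<⇒≤ (n≤length-Φ (suc n))))))

TPrefix-take-φ^-l1 : ∀ k r → r < length (φ^ k (l1 ∷ [])) → TPrefix (take r (φ^ k (l1 ∷ [])))
TPrefix-take-φ^-l1 0             0             _             = 0 , _ , refl
TPrefix-take-φ^-l1 0             (suc r)       (s≤s ())
TPrefix-take-φ^-l1 1             0             _             = 0 , _ , refl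
TPrefix-take-φ^-l1 1             1             _             = 0 , [] , refl
TPrefix-take-φ^-l1 1             (suc (suc r)) (s≤s (s≤s ()))
TPrefix-take-φ^-l1 (suc (suc j)) r             _             = 2 + j , ≼-trans (take-≼ r _) (φ^-l1-≼-Φ j)

tPrefix-split : ∀ k n → T (3 + k) ≤ n → n < T (4 + k) → tPrefix n ≡ Φ k ++ tPrefix (n ∸ T (3 + k))
tPrefix-split k n lo hi = begin
  tPrefix n                          ≡⟨ tPrefix-take n (suc k) n≤Φ ⟩
  take n (Φ (suc k))                 ≡⟨ cong (take n) (Φ-suc k) ⟩
  take n (Φ k ++ y)                  ≡⟨ take-++ʳ n (Φ k) y (≤-trans (≤-reflexive (length-Φ k)) lo) ⟩
  Φ k ++ take (n ∸ length (Φ k)) y   ≡⟨ cong (λ m → Φ k ++ take (n ∸ m) y) (length-Φ k) ⟩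
  Φ k ++ take r y                    ≡⟨ cong (Φ k ++_) (sym take-is-tPrefix) ⟩
  Φ k ++ tPrefix r                   ∎
  where
  open ≡-Reasoning
  y : Word
  y = φ^ k (l1 ∷ [])
  r : ℕ
  r = n ∸ T (3 + k)
  n≤Φ : n ≤ length (Φ (suc k))
  n≤Φ = ≤-trans (<⇒≤ hi) (≤-reflexive (sym (length-Φ (suc k))))
  lengths : T (3 + k) + length y ≡ T (4 + k)
  lengths = begin
    T (3 + k) + length y            ≡⟨ cong (_+ length y) (sym (length-Φ k)) ⟩
    length (Φ k) + length y         ≡⟨ sym (length-++ (Φ k)) ⟩
    length (Φ k ++ y)               ≡⟨ cong length (sym (Φ-suc k)) ⟩
    length (Φ (suc k))              ≡⟨ length-Φ (suc k) ⟩
    T (4 + k)                       ∎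
  r<y : r < length y
  r<y = +-cancelˡ-< (T (3 + k)) r (length y) (subst₂ _<_ (sym (m+[n∸m]≡n lo)) (sym lengths) hi)
  take-is-tPrefix : tPrefix r ≡ take r y
  take-is-tPrefix =
    trans (cong tPrefix (sym (length-take-≤ r y (<⇒≤ r<y)))) (tPrefix-length (TPrefix-take-φ^-l1 k r r<y))

imageLength : ℕ → ℕ
imageLength n = length (φ* (tPrefix n))

tPrefix-imageLength : ∀ n → tPrefix (imageLength n) ≡ φ* (tPrefix n)
tPrefix-imageLength n = tPrefix-length (TPrefix-φ* (TPrefix-tPrefix n))

tPrefix-imageLength+1 : ∀ n → tPrefix (imageLength n + 1) ≡ φ* (tPrefix n) ++ l0 ∷ []
tPrefix-imageLength+1 n
  with a , e ← tPrefix-suc n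
  with r , φa≡ ← φ-head a =
  trans (cong tPrefix (sym (length-++ (φ* (tPrefix n)))))
        (tPrefix-length (TPrefix-≼ (TPrefix-φ* (TPrefix-tPrefix (suc n))) (r , extends)))
  where
  extends : φ* (tPrefix (suc n)) ≡ (φ* (tPrefix n) ++ l0 ∷ []) ++ r
  extends = trans (cong φ* e) (trans (φ*-∷ʳ (tPrefix n) a)
              (trans (cong (φ* (tPrefix n) ++_) φa≡) (sym (++-assoc (φ* (tPrefix n)) (l0 ∷ []) r))))

imageLength-split : ∀ k n → T (3 + k) ≤ n → n < T (4 + k) →
                    imageLength n ≡ T (4 + k) + imageLength (n ∸ T (3 + k))
imageLength-split k n lo hi = begin
  length (φ* (tPrefix n))                            ≡⟨ cong (length ∘ φ*) (tPrefix-split k n lo hi) ⟩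
  length (φ* (Φ k ++ tPrefix r))                     ≡⟨ cong length (φ*-++ (Φ k) (tPrefix r)) ⟩
  length (Φ (suc k) ++ φ* (tPrefix r))               ≡⟨ length-++ (Φ (suc k)) ⟩
  length (Φ (suc k)) + imageLength r                 ≡⟨ cong (_+ imageLength r) (length-Φ (suc k)) ⟩
  T (4 + k) + imageLength r                          ∎
  where
  open ≡-Reasoning
  r : ℕ
  r = n ∸ T (3 + k)

imageLength-suc : ∀ n → imageLength (suc n) ≡ imageLength n + 1 ⊎ imageLength (suc n) ≡ imageLength n + 2
imageLength-suc n with a , e ← tPrefix-suc n = by-letter a (growth a e)
  where
  growth : ∀ a → tPrefix (suc n) ≡ tPrefix n ++ a ∷ [] → imageLength (suc n) ≡ imageLength n + length (φ a)
  growth a e =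
    trans (cong (length ∘ φ*) e) (trans (cong length (φ*-∷ʳ (tPrefix n) a)) (length-++ (φ* (tPrefix n))))
  by-letter : ∀ a → imageLength (suc n) ≡ imageLength n + length (φ a) →
              imageLength (suc n) ≡ imageLength n + 1 ⊎ imageLength (suc n) ≡ imageLength n + 2
  by-letter zero             = inj₂
  by-letter (suc zero)       = inj₂
  by-letter (suc (suc zero)) = inj₁

imageLength-<-suc : ∀ n → imageLength n < imageLength (suc n)
imageLength-<-suc n with imageLength-suc n
... | inj₁ e = subst (imageLength n <_) (sym e) (m<m+n (imageLength n) z<s)
... | inj₂ e = subst (imageLength n <_) (sym e) (m<m+n (imageLength n) z<s)

imageLength-strict : ∀ {m n} → m < n → imageLength m < imageLength n
imageLength-strict m<n = go (≤⇒≤′ m<n)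
  where
  go : ∀ {m n} → suc m ≤′ n → imageLength m < imageLength n
  go {m} ≤′-refl                 = imageLength-<-suc m
  go {n = suc n} (≤′-step m<′n) = <-trans (go m<′n) (imageLength-<-suc n)

n<imageLength : ∀ n → 0 < n → n < imageLength n
n<imageLength (suc zero)    _ = s≤s (s≤s z≤n)
n<imageLength (suc (suc n)) _ = <-≤-trans (s≤s (n<imageLength (suc n) (s≤s z≤n))) (imageLength-<-suc (suc n))

imageLength-T : ∀ j → imageLength (T (3 + j)) ≡ T (4 + j)
imageLength-T j = begin
  length (φ* (tPrefix (T (3 + j))))
    ≡⟨ cong (λ n → length (φ* (tPrefix n))) (sym (length-Φ j)) ⟩
  length (φ* (tPrefix (length (Φ j))))
    ≡⟨ cong (length ∘ φ*) (tPrefix-length (j , [] , sym (++-identityʳ (Φ j)))) ⟩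
  length (Φ (suc j))
    ≡⟨ length-Φ (suc j) ⟩
  T (4 + j)
    ∎
  where open ≡-Reasoning

imageLength-digit : ∀ N → ∃[ n ] Σ (Fin 2) λ d → N ≡ imageLength n + toℕ d
imageLength-digit zero = 0 , zero , refl
imageLength-digit (suc N) with imageLength-digit N
... | n , zero , e = n , suc zero , trans (cong suc e) (sym (+-suc (imageLength n) 0))
... | n , suc zero , e with imageLength-suc n
...   | inj₁ e′ = suc n , suc zero , trans (cong suc e) (trans (+-comm 1 _) (cong (_+ 1) (sym e′)))
...   | inj₂ e′ =
  suc n , zero , trans (cong suc e) (trans (sym (+-suc (imageLength n) 1)) (trans (sym e′) (sym (+-identityʳ _))))

-- Normal T-representations

weight : ℕ → ℕ
weight j = T (j + 3)

weight≡T : ∀ j → weight j ≡ T (3 + j)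
weight≡T j = cong T (+-comm j 3)

value : (ℕ → ℕ) → List ℕ → ℕ
value ω []       = 0
value ω (d ∷ ds) = d * ω (length ds) + value ω ds

value-∷ʳ : ∀ ω ds d → value ω (ds ++ d ∷ []) ≡ value (ω ∘ suc) ds + d * ω 0
value-∷ʳ ω []       d = +-identityʳ (d * ω 0)
value-∷ʳ ω (x ∷ ds) d = begin
  x * ω (length (ds ++ d ∷ [])) + value ω (ds ++ d ∷ [])
    ≡⟨ cong₂ (λ m v → x * ω m + v) length-∷ʳ (value-∷ʳ ω ds d) ⟩
  x * ω (suc (length ds)) + (value (ω ∘ suc) ds + d * ω 0)
    ≡⟨ sym (+-assoc (x * ω (suc (length ds))) _ _) ⟩
  x * ω (suc (length ds)) + value (ω ∘ suc) ds + d * ω 0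
    ∎
  where
  open ≡-Reasoning
  length-∷ʳ : length (ds ++ d ∷ []) ≡ suc (length ds)
  length-∷ʳ = trans (length-++ ds) (+-comm (length ds) 1)

value-dropWhile-0 : ∀ ω ds → value ω (dropWhile (ℕ._≟ 0) ds) ≡ value ω ds
value-dropWhile-0 ω []          = refl
value-dropWhile-0 ω (zero ∷ ds) = value-dropWhile-0 ω ds
value-dropWhile-0 ω (suc _ ∷ _) = refl

length-greedy : ∀ k n → length (greedy k n) ≡ suc k
length-greedy zero    n with T 3 ≤ᵇ n
... | true  = refl
... | false = refl
length-greedy (suc k) n with weight (suc k) ≤ᵇ n
... | true  = cong suc (length-greedy k _)
... | false = cong suc (length-greedy k _)

remainder-bound : ∀ k n → weight (suc k) ≤ n → n < weight (2 + k) → n ∸ weight (suc k) < weight (suc k)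
remainder-bound k n rewrite weight≡T (suc k) | weight≡T (2 + k) = λ lo hi →
  <-≤-trans
    (+-cancelˡ-< (T (4 + k)) _ _ (subst₂ _<_ (sym (m+[n∸m]≡n lo)) (+-assoc (T (4 + k)) (T (3 + k)) _) hi))
    (m≤m+n _ (T (1 + k)))

greedy-value : ∀ k n → n < weight (suc k) → value weight (greedy k n) ≡ n
greedy-value zero    0             _                = refl
greedy-value zero    1             _                = refl
greedy-value zero    (suc (suc n)) (s≤s (s≤s ()))
greedy-value (suc k) n             n< with weight (suc k) ≤ᵇ n | ≤ᵇ-reflects-≤ (weight (suc k)) n
... | false | ofⁿ w≰n = greedy-value k n (≰⇒> w≰n)
... | true  | ofʸ w≤n = begin
  1 * weight (length (greedy k r)) + value weight (greedy k r)
    ≡⟨ cong₂ (λ m v → 1 * weight m + v) (length-greedy k r) (greedy-value k r (remainder-bound k n w≤n n<)) ⟩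
  1 * weight (suc k) + r
    ≡⟨ cong (_+ r) (*-identityˡ (weight (suc k))) ⟩
  weight (suc k) + r
    ≡⟨ m+[n∸m]≡n w≤n ⟩
  n
    ∎
  where
  open ≡-Reasoning
  r : ℕ
  r = n ∸ weight (suc k)

greedy-shift : ∀ k n → n < weight (suc k) → value (weight ∘ suc) (greedy k n) ≡ imageLength n
greedy-shift zero    0             _                = refl
greedy-shift zero    1             _                = refl
greedy-shift zero    (suc (suc n)) (s≤s (s≤s ()))
greedy-shift (suc k) n             n< with weight (suc k) ≤ᵇ n | ≤ᵇ-reflects-≤ (weight (suc k)) n
... | false | ofⁿ w≰n = greedy-shift k n (≰⇒> w≰n)
... | true  | ofʸ w≤n = begin
  1 * weight (suc (length (greedy k r))) + value (weight ∘ suc) (greedy k r)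
    ≡⟨ cong₂ (λ m v → 1 * weight (suc m) + v)
             (length-greedy k r) (greedy-shift k r (remainder-bound k n w≤n n<)) ⟩
  1 * weight (2 + k) + imageLength r
    ≡⟨ cong₂ _+_ (trans (*-identityˡ _) (weight≡T (2 + k))) (cong (imageLength ∘ (n ∸_)) (weight≡T (suc k))) ⟩
  T (5 + k) + imageLength (n ∸ T (4 + k))
    ≡⟨ sym (imageLength-split (suc k) n (subst (_≤ n) (weight≡T (suc k)) w≤n)
                                        (subst (n <_) (weight≡T (2 + k)) n<)) ⟩
  imageLength n
    ∎
  where
  open ≡-Reasoning
  r : ℕ
  r = n ∸ weight (suc k)

reprT-∷ʳ : ∀ N n d → reprT N ≡ reprT n ++ d ∷ [] → N ≡ imageLength n + d
reprT-∷ʳ N n d e = begin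
  N                                                  ≡⟨ sym (greedy-value N N (bound N)) ⟩
  value weight (greedy N N)                          ≡⟨ sym (value-dropWhile-0 weight (greedy N N)) ⟩
  value weight (reprT N)                             ≡⟨ cong (value weight) e ⟩
  value weight (reprT n ++ d ∷ [])                   ≡⟨ value-∷ʳ weight (reprT n) d ⟩
  value (weight ∘ suc) (reprT n) + d * 1             ≡⟨ cong₂ _+_ (value-dropWhile-0 _ (greedy n n)) (*-identityʳ d) ⟩
  value (weight ∘ suc) (greedy n n) + d              ≡⟨ cong (_+ d) (greedy-shift n n (bound n)) ⟩
  imageLength n + d                                  ∎
  where
  open ≡-Reasoning
  bound : ∀ n → n < weight (suc n)
  bound n = subst (n <_) (sym (weight≡T (suc n))) (<-trans (n<1+n n) (<T-3+ (suc n)))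

φ-parikh : Parikh → Parikh
φ-parikh (x , y , z) = x + y + z , x , y

φ-parikh-⊕ : ∀ u u' → φ-parikh (u ⊕ u') ≡ φ-parikh u ⊕ φ-parikh u'
φ-parikh-⊕ (x , y , z) (x' , y' , z') = cong (_, x + x' , y + y') (regroup x y z x' y' z')
  where
  open +-*-Solver
  regroup : ∀ x y z x' y' z' → x + x' + (y + y') + (z + z') ≡ x + y + z + (x' + y' + z')
  regroup = solve 6 (λ x y z x' y' z' → x :+ x' :+ (y :+ y') :+ (z :+ z') := x :+ y :+ z :+ (x' :+ y' :+ z')) refl

Ψ-φ* : ∀ x → Ψ (φ* x) ≡ φ-parikh (Ψ x)
Ψ-φ* []      = refl
Ψ-φ* (a ∷ x) = begin
  Ψ (φ a ++ φ* x)                              ≡⟨ Ψ-++ (φ a) (φ* x) ⟩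
  Ψ (φ a) ⊕ Ψ (φ* x)                           ≡⟨ cong₂ _⊕_ (Ψ-φ a) (Ψ-φ* x) ⟩
  φ-parikh (Ψ (a ∷ [])) ⊕ φ-parikh (Ψ x)       ≡⟨ sym (φ-parikh-⊕ (Ψ (a ∷ [])) (Ψ x)) ⟩
  φ-parikh (Ψ (a ∷ []) ⊕ Ψ x)                  ≡⟨ cong φ-parikh (sym (Ψ-++ (a ∷ []) x)) ⟩
  φ-parikh (Ψ (a ∷ x))                         ∎
  where
  open ≡-Reasoning
  Ψ-φ : ∀ a → Ψ (φ a) ≡ φ-parikh (Ψ (a ∷ []))
  Ψ-φ zero             = refl
  Ψ-φ (suc zero)       = refl
  Ψ-φ (suc (suc zero)) = refl

Ψ-φ*-cong : ∀ a b → Ψ a ≡ Ψ b → Ψ (φ* a) ≡ Ψ (φ* b)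
Ψ-φ*-cong a b e = trans (Ψ-φ* a) (trans (cong φ-parikh e) (sym (Ψ-φ* b)))

rotate : Fin 2 → Word → Word
rotate zero       u = u
rotate (suc zero) u = (l0 ∷ []) ⁻¹· (u ++ l0 ∷ [])

rotate-[] : ∀ d → rotate d [] ≡ []
rotate-[] zero       = refl
rotate-[] (suc zero) = refl

rotate-φ*-++ : ∀ d x y → x ≢ [] → rotate d (φ* x) ++ rotate d (φ* y) ≡ rotate d (φ* x ++ φ* y)
rotate-φ*-++ zero       x y _ = refl
rotate-φ*-++ (suc zero) x y x≢[] with φ*-shape x | φ*-shape y
... | inj₁ e          | _               = ⊥-elim (φ*-nonempty x x≢[] e)
... | inj₂ (u , ex)   | inj₁ ey         rewrite ex | ey =
  trans (++-identityʳ _) (cong (_++ l0 ∷ []) (sym (++-identityʳ u)))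
... | inj₂ (u , ex)   | inj₂ (u' , ey)  rewrite ex | ey =
  trans (++-assoc u (l0 ∷ []) (u' ++ l0 ∷ [])) (sym (++-assoc u (l0 ∷ u') (l0 ∷ [])))

rotate-φ*-block : ∀ d x → x ≢ [] → rotate d (φ* x) ≢ [] × Ψ (rotate d (φ* x)) ≡ Ψ (φ* x)
rotate-φ*-block zero       x x≢[] = φ*-nonempty x x≢[] , refl
rotate-φ*-block (suc zero) x x≢[] with φ*-shape x
... | inj₁ e        = ⊥-elim (φ*-nonempty x x≢[] e)
... | inj₂ (u , e) rewrite e = ∷ʳ-nonempty u , Ψ-++-comm u (l0 ∷ [])
  where
  ∷ʳ-nonempty : ∀ u → u ++ l0 ∷ [] ≢ []
  ∷ʳ-nonempty [] ()
  ∷ʳ-nonempty (_ ∷ _) ()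

φ-image : Fin 2 → Word × Word → Word × Word
φ-image d q = φ* (proj₁ q) , rotate d (φ* (proj₂ q))

φ-image-factorization : ∀ d → IsFactorization v w H →
                        IsFactorization (φ* v) (rotate d (φ* w)) (map (φ-image d) H)
φ-image-factorization {H = []} d (refl , refl , []) = refl , sym (rotate-[] d) , []
φ-image-factorization {H = (a , b) ∷ H} d (refl , refl , (a≢[] , b≢[] , Ψa≡Ψb) ∷ bs)
  with uH , lH , bsH ← φ-image-factorization {H = H} d (refl , refl , bs)
  with rb≢[] , Ψrb ← rotate-φ*-block d b b≢[] =
  trans (cong (φ* a ++_) uH) (sym (φ*-++ a (tops H))) ,
  trans (cong (rotate d (φ* b) ++_) lH)
        (trans (rotate-φ*-++ d b (bottoms H) b≢[]) (cong (rotate d) (sym (φ*-++ b (bottoms H))))) ,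
  (φ*-nonempty a a≢[] , rb≢[] , trans (Ψ-φ*-cong a b Ψa≡Ψb) (sym Ψrb)) ∷ bsH

ext : Fin 2 → Word
ext zero       = []
ext (suc zero) = l0 ∷ []

rotate≡⁻¹· : ∀ d u → rotate d u ≡ ext d ⁻¹· (u ++ ext d)
rotate≡⁻¹· zero       u = sym (++-identityʳ u)
rotate≡⁻¹· (suc zero) u = refl

tPrefix-imageLength+ : ∀ n d → tPrefix (imageLength n + toℕ d) ≡ φ* (tPrefix n) ++ ext d
tPrefix-imageLength+ n zero       =
  trans (cong tPrefix (+-identityʳ _)) (trans (tPrefix-imageLength n) (sym (++-identityʳ _)))
tPrefix-imageLength+ n (suc zero) = tPrefix-imageLength+1 n

-- The sets Z(n)

Φ-conjugate : ℕ → ℕ → Word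
Φ-conjugate n m = tPrefix n ⁻¹· (Φ m ++ tPrefix n)

-- Z n (K + 3) p unfolds to p ∈Z[ n , K ].
Z : ℕ → ℕ → Word × Word → Set
Z n m p = p ∈Dec Φ m / Φ-conjugate n m

Φ-split : ∀ n k → n ≤ length (Φ k) → Φ k ≡ tPrefix n ++ drop n (Φ k)
Φ-split n k n≤ = trans (sym (take++drop≡id n (Φ k))) (cong (_++ drop n (Φ k)) (sym (tPrefix-take n k n≤)))

Φ-conjugate-split : ∀ n k → n ≤ length (Φ k) → Φ-conjugate n k ≡ drop n (Φ k) ++ tPrefix n
Φ-conjugate-split n k n≤ = begin
  drop (length P) (Φ k ++ P)            ≡⟨ cong (λ x → drop (length P) (x ++ P)) (Φ-split n k n≤) ⟩
  drop (length P) ((P ++ s) ++ P)       ≡⟨ cong (drop (length P)) (++-assoc P s P) ⟩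
  drop (length P) (P ++ s ++ P)         ≡⟨ drop-length-++ P (s ++ P) ⟩
  s ++ P                                ∎
  where
  open ≡-Reasoning
  P : Word
  P = tPrefix n
  s : Word
  s = drop n (Φ k)

Φ-conjugate-block : ∀ n k → n ≤ length (Φ k) → Block (Φ k , Φ-conjugate n k)
Φ-conjugate-block n k n≤ =
  subst₂ (λ a b → Block (a , b)) (sym (Φ-split n k n≤)) (sym (Φ-conjugate-split n k n≤))
    (conjugate-block (tPrefix n) (drop n (Φ k)) (subst (_≢ []) (Φ-split n k n≤) (Φ-nonempty k)))

Φ-conjugate-image : ∀ d n k → n ≤ length (Φ k) →
                    rotate d (φ* (Φ-conjugate n k)) ≡ Φ-conjugate (imageLength n + toℕ d) (suc k)
Φ-conjugate-image d n k n≤ = begin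
  rotate d (φ* (Φ-conjugate n k))                  ≡⟨ cong (rotate d ∘ φ*) (Φ-conjugate-split n k n≤) ⟩
  rotate d (φ* (s ++ P))                           ≡⟨ cong (rotate d) (φ*-++ s P) ⟩
  rotate d (φ* s ++ φ* P)                          ≡⟨ rotate≡⁻¹· d (φ* s ++ φ* P) ⟩
  e ⁻¹· ((φ* s ++ φ* P) ++ e)                      ≡⟨ sym (⁻¹·-conjugate (φ* P) (φ* s) e) ⟩
  (φ* P ++ e) ⁻¹· ((φ* P ++ φ* s) ++ (φ* P ++ e))  ≡⟨ cong (λ x → (φ* P ++ e) ⁻¹· (x ++ (φ* P ++ e))) φ*-Φ ⟩
  (φ* P ++ e) ⁻¹· (Φ (suc k) ++ (φ* P ++ e))       ≡⟨ cong (λ x → x ⁻¹· (Φ (suc k) ++ x)) t[N] ⟩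
  Φ-conjugate (imageLength n + toℕ d) (suc k)      ∎
  where
  open ≡-Reasoning
  P s e : Word
  P = tPrefix n
  s = drop n (Φ k)
  e = ext d
  φ*-Φ : φ* P ++ φ* s ≡ Φ (suc k)
  φ*-Φ = sym (trans (cong φ* (Φ-split n k n≤)) (φ*-++ P s))
  t[N] : φ* P ++ e ≡ tPrefix (imageLength n + toℕ d)
  t[N] = sym (tPrefix-imageLength+ n d)

Z-step : ∀ d n k → n ≤ length (Φ k) → ∀ p →
         Z (imageLength n + toℕ d) (suc k) p ⇔ (∃[ q ] Z n k q × p ∈Decᵖ φ-image d q)
Z-step d n k n≤ p = image (atomicFactorization (Φ-conjugate-block n k n≤))
  where
  image : ∃ (AtomicFactorization (Φ k) (Φ-conjugate n k)) →
          Z (imageLength n + toℕ d) (suc k) p ⇔ (∃[ q ] Z n k q × p ∈Decᵖ φ-image d q)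
  image (H , atH) =
    ∈Dec-image (φ-image d) atH
      (subst (λ w → IsFactorization (Φ (suc k)) w (map (φ-image d) H)) (Φ-conjugate-image d n k n≤)
         (φ-image-factorization d (proj₁ atH)))
      p

Z-zero : ∀ m → 2 ≤ m → ∀ p → Z 0 m p ⇔ (∃[ a ] p ≡ diag a)
Z-zero m 2≤m p = mk⇔ to from ⇔-∘ ∈Dec⇔∈ atomic p
  where
  atomic : AtomicFactorization (Φ m) (Φ m ++ []) (map diag (Φ m))
  atomic = subst (λ w → AtomicFactorization (Φ m) w (map diag (Φ m))) (sym (++-identityʳ (Φ m)))
                 (diagonal-atomic (Φ m))
  to : p ∈ map diag (Φ m) → ∃[ a ] p ≡ diag a
  to p∈ with a , _ , e ← ∈-map⁻ diag p∈ = a , e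
  from : ∃[ a ] p ≡ diag a → p ∈ map diag (Φ m)
  from (a , refl) = ∈-map⁺ diag (all-letters m 2≤m a)

-- The bound 3 ≤ m for positive n is needed: Z(1) at level 2 lacks the pair (0 , 0) that occurs at level 3.
Admissible : ℕ → ℕ → Set
Admissible n m = n ≤ T m × 2 ≤ m × (0 < n → 3 ≤ m)

admissible : ∀ {x j j'} → x ≤ T j → 3 ≤ j → j ≤ j' → Admissible x j'
admissible {j' = j'} x≤T 3≤j j≤j' = ≤-trans x≤T (T-mono j≤j') , ≤-trans (n≤1+n 2) 3≤j' , λ _ → 3≤j'
  where
  3≤j' : 3 ≤ j'
  3≤j' = ≤-trans 3≤j j≤j'

Admissible⇒≤length-Φ : ∀ {n k} → Admissible n k → n ≤ length (Φ k)
Admissible⇒≤length-Φ {k = k} (n≤T , _) =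
  ≤-trans n≤T (≤-trans (T-mono (m≤n+m k 3)) (≤-reflexive (sym (length-Φ k))))

n<imageLength+d : ∀ n (d : Fin 2) → 0 < imageLength n + toℕ d → n < imageLength n + toℕ d
n<imageLength+d zero    _ 0< = 0<
n<imageLength+d (suc n) d _  = <-≤-trans (n<imageLength (suc n) z<s) (m≤m+n _ (toℕ d))

admissible-descent : ∀ {N n k} {d : Fin 2} → 0 < N → N ≡ imageLength n + toℕ d →
                     Admissible N (suc k) → Admissible n k × n < N
admissible-descent {N} {n} {k} {d} 0<N refl (N≤T , _ , 3≤) = by-level k N≤T (3≤ 0<N) , n<N
  where
  n<N : n < N
  n<N = n<imageLength+d n d 0<N
  by-level : ∀ k → N ≤ T (suc k) → 3 ≤ suc k → Admissible n k
  by-level 0 _ (s≤s ())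
  by-level 1 _ (s≤s (s≤s ()))
  by-level 2 N≤1 _ = <⇒≤ n<1 , ≤-refl , λ 0<n → ⊥-elim (<-irrefl refl (<-≤-trans 0<n (≤-pred n<1)))
    where
    n<1 : n < 1
    n<1 = ≤-trans n<N N≤1
  by-level (suc (suc (suc j))) N≤T _ with n ≤? T (3 + j)
  ... | yes n≤T = n≤T , s≤s (s≤s z≤n) , λ _ → s≤s (s≤s (s≤s z≤n))
  ... | no  n≰T = ⊥-elim (<-irrefl refl (<-≤-trans (imageLength-strict (≰⇒> n≰T)) bounded))
    where
    bounded : imageLength n ≤ imageLength (T (3 + j))
    bounded = ≤-trans (m≤m+n _ (toℕ d)) (subst (N ≤_) (sym (imageLength-T j)) N≤T)

∃×-congˡ : ∀ {P Q R : Word × Word → Set} → (∀ q → P q ⇔ Q q) →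
           (∃[ q ] P q × R q) ⇔ (∃[ q ] Q q × R q)
∃×-congˡ P⇔Q = mk⇔ (map₂ (map₁ (Equivalence.to (P⇔Q _)))) (map₂ (map₁ (Equivalence.from (P⇔Q _))))

LevelIndependent : ℕ → Set
LevelIndependent n = ∀ {m m'} → Admissible n m → Admissible n m' → ∀ p → Z n m p ⇔ Z n m' p

-- Induction on n: write n = |φ(t[n'])| + d with n' < n and peel one level off both sides with Z-step.
Z-level-independent : ∀ n → LevelIndependent n
Z-level-independent = <-rec LevelIndependent go
  where
  go : ∀ N → (∀ {n} → n < N → LevelIndependent n) → LevelIndependent N
  go zero    _   (_ , 2≤m , _) (_ , 2≤m' , _) p = ⇔-sym (Z-zero _ 2≤m' p) ⇔-∘ Z-zero _ 2≤m p
  go (suc N) rec {suc k} {suc k'} adm adm' p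
    with n , d , e ← imageLength-digit (suc N)
    with (admₖ , n<N) ← admissible-descent z<s e adm | (admₖ' , _) ← admissible-descent z<s e adm' =
    subst (λ N → Z N (suc k) p ⇔ Z N (suc k') p) (sym e) (begin
      Z (imageLength n + toℕ d) (suc k) p     ≈⟨ Z-step d n k (Admissible⇒≤length-Φ admₖ) p ⟩
      (∃[ q ] Z n k q × p ∈Decᵖ φ-image d q)  ≈⟨ ∃×-congˡ (rec n<N admₖ admₖ') ⟩
      (∃[ q ] Z n k' q × p ∈Decᵖ φ-image d q) ≈⟨ ⇔-sym (Z-step d n k' (Admissible⇒≤length-Φ admₖ') p) ⟩
      Z (imageLength n + toℕ d) (suc k') p    ∎)
    where open import Relation.Binary.Reasoning.Setoid (⇔-setoid 0ℓ)

-- Z-step raises the level by exactly one, so n and N are first moved to the common levels M and M + 1.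
Z-recursion : ∀ (d : Fin 2) N n K K' → n ≤ T (K + 3) → N ≤ T (K' + 3) → N ≡ imageLength n + toℕ d → ∀ p →
              Z N (K' + 3) p ⇔ (∃[ q ] Z n (K + 3) q × p ∈Decᵖ φ-image d q)
Z-recursion d N n K K' n≤T N≤T refl p = begin
  Z N (K' + 3) p                               ≈⟨ Z-level-independent N (at K' N≤T ≤-refl) (at K' N≤T K'+3≤1+M) p ⟩
  Z N (suc M) p                                ≈⟨ Z-step d n M (Admissible⇒≤length-Φ n-at-M) p ⟩
  (∃[ q ] Z n M q × p ∈Decᵖ φ-image d q)       ≈⟨ ∃×-congˡ (Z-level-independent n n-at-M (at K n≤T ≤-refl)) ⟩
  (∃[ q ] Z n (K + 3) q × p ∈Decᵖ φ-image d q) ∎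
  where
  open import Relation.Binary.Reasoning.Setoid (⇔-setoid 0ℓ)
  M : ℕ
  M = K + K' + 3
  at : ∀ j {x j'} → x ≤ T (j + 3) → j + 3 ≤ j' → Admissible x j'
  at j x≤T = admissible x≤T (m≤n+m 3 j)
  K'+3≤1+M : K' + 3 ≤ suc M
  K'+3≤1+M = m≤n⇒m≤1+n (+-monoˡ-≤ 3 (m≤n+m K' K))
  n-at-M : Admissible n M
  n-at-M = at K n≤T (+-monoˡ-≤ 3 (m≤m+n K K'))

corollary6 : (N n : ℕ) → 0 < N → 0 < n →
    (∀ K K' → n ≤ T (K + 3) → N ≤ T (K' + 3) →
      (reprT N ≡ reprT n ++ (0 ∷ []) →
        ∀ (p : Word × Word) →
          p ∈Z[ N , K' ] ⇔ Σ (Word × Word) λ q → q ∈Z[ n , K ] ×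
            p ∈Dec φ* (proj₁ q) / φ* (proj₂ q))
      ×
      (reprT N ≡ reprT n ++ (1 ∷ []) →
        ∀ (p : Word × Word) →
          p ∈Z[ N , K' ] ⇔ Σ (Word × Word) λ q → q ∈Z[ n , K ] ×
            p ∈Dec φ* (proj₁ q) / ((l0 ∷ []) ⁻¹· (φ* (proj₂ q) ++ (l0 ∷ [])))))
corollary6 N n _ _ K K' n≤T N≤T = digit zero , digit (suc zero)
  where
  digit : ∀ d → reprT N ≡ reprT n ++ toℕ d ∷ [] → ∀ p →
          Z N (K' + 3) p ⇔ (∃[ q ] Z n (K + 3) q × p ∈Decᵖ φ-image d q)
  digit d repr = Z-recursion d N n K K' n≤T N≤T (reprT-∷ʳ N n (toℕ d) repr)
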